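{- Let $\eta=(\eta_0,\ldots,\eta_n)$ be a partial orbit in a meet-tree. Let $k$ be a positive integer with $k\leq n/2$, and let $i_1,i_2,j_1,j_2\in\{0,\ldots,n\}$ satisfy $i_1\equiv i_2\equiv j_1\equiv j_2\pmod k$, $i_1<i_2$ and $j_1<j_2$. (1) If $\eta_0\mathbin{\wedge}\eta_k<\eta_k\mathbin{\wedge}\eta_{2k}$ (in particular if $\eta$ is an ascending $k$-spiral or ascending $k$-comb), then (a) $\eta_{i_1}\mathbin{\wedge}\eta_{i_2}=\eta_{i_1}\mathbin{\wedge}\eta_{i_1+k}$, and (b) the pair $(\eta_{i_1}\mathbin{\wedge}\eta_{i_2},\eta_{j_1}\mathbin{\wedge}\eta_{j_2})$ has the same order type as the pair of integers $(i_1,j_1)$, i.e.\ $\eta_{i_1}\mathbin{\wedge}\eta_{i_2}<$, $=$, $>\ \eta_{j_1}\mathbin{\wedge}\eta_{j_2}$ according as $i_1<j_1$, $i_1=j_1$, $i_1>j_1$. (2) If $\eta_0\mathbin{\wedge}\eta_k>\eta_k\mathbin{\wedge}\eta_{2k}$ (in particular if $\eta$ is a descending $k$-spiral or descending $k$-comb), then (a) $\eta_{i_1}\mathbin{\wedge}\eta_{i_2}=\eta_{i_2-k}\mathbin{\wedge}\eta_{i_2}$, and (b) the pair $(\eta_{i_1}\mathbin{\wedge}\eta_{i_2},\eta_{j_1}\mathbin{\wedge}\eta_{j_2})$ has the same order type as the pair of integers $(j_2,i_2)$.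
   Context: A meet-tree is a structure $(A,\leq,\mathbin{\wedge})$ where $\leq$ is a partial order such that each $A_{\leq a}=\{x:x\leq a\}$ is linearly ordered, any two elements have a common lower bound, and $a\mathbin{\wedge} b$ is the largest element of $A_{\leq a}\cap A_{\leq b}$. A partial orbit is a finite sequence $(\eta_0,\ldots,\eta_n)$ such that $\eta_i\mapsto\eta_{i+1}$ ($i<n$) is a partial automorphism (preserves quantifier-free types in $\{\leq,\mathbin{\wedge}\}$). It is an ascending (descending) $k$-spiral if $k$ is the least positive integer with $\eta_k>\eta_0$ ($\eta_k<\eta_0$); an ascending (descending) $k$-comb if it is not a spiral and $k$ is the least positive integer with $\eta_{2k}\mathbin{\wedge}\eta_k>\eta_k\mathbin{\wedge}\eta_0$ ($\eta_{2k}\mathbin{\wedge}\eta_k<\eta_k\mathbin{\wedge}\eta_0$). -}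

module Defs where

open import Level using (Level; _⊔_; suc)
open import Data.Nat as ℕ using (ℕ)
open import Data.Fin using (Fin; toℕ)
open import Data.Product using (Σ; ∃; _×_)
open import Data.Sum using (_⊎_)
open import Function.Bundles using (_⇔_)
open import Relation.Binary.PropositionalEquality using (_≡_; _≢_)
open import Relation.Binary.Structures using (IsPartialOrder)

record MeetTree (a ℓ : Level) : Set (Level.suc (a ⊔ ℓ)) where
  infix 4 _≤_ _<_
  infixl 7 _∧_
  field
    Carrier   : Set a
    _≤_       : Carrier → Carrier → Set ℓ
    _∧_       : Carrier → Carrier → Carrier
    isPartialOrder : IsPartialOrder _≡_ _≤_
    downLinear : ∀ a x y → x ≤ a → y ≤ a → x ≤ y ⊎ y ≤ x
    lowerBound : ∀ a b → ∃ λ c → c ≤ a × c ≤ b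
    ∧-lb₁     : ∀ a b → a ∧ b ≤ a
    ∧-lb₂     : ∀ a b → a ∧ b ≤ b
    ∧-greatest : ∀ a b c → c ≤ a → c ≤ b → c ≤ a ∧ b

  _<_ : Carrier → Carrier → Set (a ⊔ ℓ)
  x < y = x ≤ y × x ≢ y

data Term (m : ℕ) : Set where
  var  : Fin m → Term m
  meet : Term m → Term m → Term m

module _ {a ℓ} (T : MeetTree a ℓ) where
  open MeetTree T

  eval : ∀ {m} → (Fin m → Carrier) → Term m → Carrier
  eval ρ (var i)    = ρ i
  eval ρ (meet t s) = eval ρ t ∧ eval ρ s

  -- ρ and σ have the same quantifier-free type in {≤, ∧}
  -- (atomic formulas are t = s and t ≤ s for terms t, s).
  SameQFType : ∀ {m} → (Fin m → Carrier) → (Fin m → Carrier) → Set (a ⊔ ℓ)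
  SameQFType {m} ρ σ = ∀ (t s : Term m) →
    ((eval ρ t ≡ eval ρ s) ⇔ (eval σ t ≡ eval σ s)) ×
    ((eval ρ t ≤ eval ρ s) ⇔ (eval σ t ≤ eval σ s))

  -- (η 0, …, η n) is a partial orbit: η_i ↦ η_{i+1} (i < n) is a partial
  -- automorphism. Values of η at indices > n are irrelevant.
  PartialOrbit : ℕ → (ℕ → Carrier) → Set (a ⊔ ℓ)
  PartialOrbit n η = SameQFType {n} (λ i → η (toℕ i)) (λ i → η (ℕ.suc (toℕ i)))

meetᵀ : ∀ {a ℓ} (T : MeetTree a ℓ) → MeetTree.Carrier T → MeetTree.Carrier T → MeetTree.Carrier T
meetᵀ T = MeetTree._∧_ T

ltᵀ : ∀ {a ℓ} (T : MeetTree a ℓ) → MeetTree.Carrier T → MeetTree.Carrier T → Set (a ⊔ ℓ)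
ltᵀ T = MeetTree._<_ T

-- In a meet-tree every triangle is isosceles: of x ∧ y, y ∧ z and x ∧ z the two
-- smallest coincide. Fix a residue class r mod k and put b t = η (r + t k). The
-- orbit transports the comparison of η 0 ∧ η k with η k ∧ η 2k to every pair of
-- consecutive meets b t ∧ b (t+1), b (t+1) ∧ b (t+2), so the consecutive meets are
-- strictly monotone in t. If they increase, the isosceles property collapses
-- b s ∧ b t (s < t) to b s ∧ b (s+1), which increases with s; if they decrease, it
-- collapses b s ∧ b t to b (t-1) ∧ b t, which decreases as t grows.
module Submission where

open import Defs
open import Level using (Level; _⊔_)
open import Data.Nat using (ℕ; _+_; _*_; _∸_; _%_; _≤_; _<_; NonZero)
open import Data.Product using (_×_)
open import Relation.Binary.PropositionalEquality using (_≡_)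

open import Data.Nat using (zero; suc; s≤s; z≤n; _/_; _≤′_; _<′_; ≤′-refl; ≤′-step)
open import Data.Nat.Properties
  using (≤-refl; ≤-trans; <-trans; ≤-pred; n≤1+n; n<1+n; m≤m+n; m+n∸n≡m; +-assoc; +-comm;
         +-identityʳ; +-monoʳ-≤; ≰⇒>; <⇒≱; <⇒≤; <⇒<′; <′⇒<; ≤⇒≤′)
open import Data.Nat.DivMod using (m≡m%n+[m/n]*n)
open import Data.Fin using (fromℕ<)
open import Data.Fin.Properties using (toℕ-fromℕ<)
open import Data.Product using (_,_; ∃-syntax)
open import Data.Sum using (inj₁; inj₂)
open import Data.Empty using (⊥-elim)
open import Function using (flip; _∘_)
open import Function.Bundles using (Equivalence)
open import Relation.Binary.Core using (Rel)
open import Relation.Binary.Definitions using (Transitive)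
open import Relation.Binary.Structures using (IsPartialOrder)
import Relation.Binary.Construct.NonStrictToStrict as NonStrictToStrict
open import Relation.Binary.PropositionalEquality
  using (refl; sym; trans; cong; subst; subst₂; module ≡-Reasoning)

consecutive⇒ordered : ∀ {a r} {A : Set a} {R : Rel A r} → Transitive R →
  (f : ℕ → A) {m : ℕ} → (∀ {t} → suc t < m → R (f t) (f (suc t))) →
  ∀ {s t} → s < t → t < m → R (f s) (f t)
consecutive⇒ordered {R = R} R-trans f {m} step s<t = go (<⇒<′ s<t)
  where
  go : ∀ {s t} → s <′ t → t < m → R (f s) (f t)
  go ≤′-refl           t<m   = step t<m
  go (≤′-step {t} s<t) 1+t<m = R-trans (go s<t (<-trans (n<1+n t) 1+t<m)) (step 1+t<m)

module MeetTreeProperties {a ℓ : Level} (T : MeetTree a ℓ) where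
  open MeetTree T renaming (_≤_ to _⊑_; _<_ to _⊏_)
  open IsPartialOrder isPartialOrder using (antisym) renaming (trans to ⊑-trans)

  ⊏-trans : Transitive _⊏_
  ⊏-trans = NonStrictToStrict.<-trans _≡_ _⊑_ isPartialOrder

  ⊐-trans : Transitive (flip _⊏_)
  ⊐-trans = flip ⊏-trans

  ∧-comm : ∀ x y → x ∧ y ≡ y ∧ x
  ∧-comm x y = antisym (∧-greatest y x (x ∧ y) (∧-lb₂ x y) (∧-lb₁ x y))
                       (∧-greatest x y (y ∧ x) (∧-lb₂ y x) (∧-lb₁ y x))

  -- x ∧ z and y ∧ z both lie below z, hence are comparable; if y ∧ z ⊑ x ∧ z then
  -- y ∧ z would be a common lower bound of x and y, contradicting x ∧ y ⊏ y ∧ z.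
  ∧-isoscelesˡ : ∀ x y z → x ∧ y ⊏ y ∧ z → x ∧ z ≡ x ∧ y
  ∧-isoscelesˡ x y z (xy⊑yz , xy≢yz) = antisym xz⊑xy xy⊑xz
    where
    xy⊑xz : x ∧ y ⊑ x ∧ z
    xy⊑xz = ∧-greatest x z (x ∧ y) (∧-lb₁ x y) (⊑-trans xy⊑yz (∧-lb₂ y z))
    xz⊑xy : x ∧ z ⊑ x ∧ y
    xz⊑xy with downLinear z (x ∧ z) (y ∧ z) (∧-lb₂ x z) (∧-lb₂ y z)
    ... | inj₁ xz⊑yz = ∧-greatest x y (x ∧ z) (∧-lb₁ x z) (⊑-trans xz⊑yz (∧-lb₁ y z))
    ... | inj₂ yz⊑xz = ⊥-elim (xy≢yz (antisym xy⊑yz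
          (∧-greatest x y (y ∧ z) (⊑-trans yz⊑xz (∧-lb₁ x z)) (∧-lb₁ y z))))

  ∧-isoscelesʳ : ∀ x y z → y ∧ z ⊏ x ∧ y → x ∧ z ≡ y ∧ z
  ∧-isoscelesʳ x y z yz⊏xy = begin
    x ∧ z  ≡⟨ ∧-comm x z ⟩
    z ∧ x  ≡⟨ ∧-isoscelesˡ z y x (subst₂ _⊏_ (∧-comm y z) (∧-comm x y) yz⊏xy) ⟩
    z ∧ y  ≡⟨ ∧-comm z y ⟩
    y ∧ z  ∎
    where open ≡-Reasoning

  module Path (b : ℕ → Carrier) where
    δ : ℕ → Carrier
    δ t = b t ∧ b (suc t)

    Ascending Descending : ℕ → Set (a ⊔ ℓ)
    Ascending  m = ∀ {t} → suc t < m → δ t ⊏ δ (suc t)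
    Descending m = ∀ {t} → suc t < m → δ (suc t) ⊏ δ t

    ascending⇒∧≡δ : ∀ {m} → Ascending m → ∀ {s t} → s < t → t ≤ m → b s ∧ b t ≡ δ s
    ascending⇒∧≡δ {m} asc s<t = go (<⇒<′ s<t)
      where
      go : ∀ {s t} → s <′ t → t ≤ m → b s ∧ b t ≡ δ s
      go ≤′-refl _ = refl
      go {s} (≤′-step {t} s<t) t<m = trans (∧-isoscelesˡ (b s) (b t) (b (suc t)) bs∧bt⊏δt) ih
        where
        ih : b s ∧ b t ≡ δ s
        ih = go s<t (≤-trans (n≤1+n t) t<m)
        bs∧bt⊏δt : b s ∧ b t ⊏ δ t
        bs∧bt⊏δt = subst (_⊏ δ t) (sym ih)
          (consecutive⇒ordered {R = _⊏_} ⊏-trans δ asc (<′⇒< s<t) t<m)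

    descending⇒∧≡δ : ∀ {m} → Descending m → ∀ {s t} → s ≤ t → suc t ≤ m → b s ∧ b (suc t) ≡ δ t
    descending⇒∧≡δ {m} desc s≤t = go (≤⇒≤′ s≤t)
      where
      go : ∀ {s t} → s ≤′ t → suc t ≤ m → b s ∧ b (suc t) ≡ δ t
      go ≤′-refl _ = refl
      go {s} (≤′-step {t} s≤t) t+1<m =
        ∧-isoscelesʳ (b s) (b (suc t)) (b (suc (suc t))) δ[1+t]⊏bs∧b[1+t]
        where
        ih : b s ∧ b (suc t) ≡ δ t
        ih = go s≤t (≤-trans (n≤1+n _) t+1<m)
        δ[1+t]⊏bs∧b[1+t] : δ (suc t) ⊏ b s ∧ b (suc t)
        δ[1+t]⊏bs∧b[1+t] = subst (δ (suc t) ⊏_) (sym ih) (desc t+1<m)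

module OrbitProperties {a ℓ : Level} (T : MeetTree a ℓ) (n : ℕ) (η : ℕ → MeetTree.Carrier T)
                       (orbit : PartialOrbit T n η) where
  open MeetTree T renaming (_≤_ to _⊑_; _<_ to _⊏_)
  open MeetTreeProperties T

  infix 5 _⋏_
  _⋏_ : ℕ → ℕ → Carrier
  i ⋏ j = η i ∧ η j

  suc-preserves-⊏ : ∀ {p q p' q'} → p < n → q < n → p' < n → q' < n →
                    p ⋏ q ⊏ p' ⋏ q' → suc p ⋏ suc q ⊏ suc p' ⋏ suc q'
  suc-preserves-⊏ p<n q<n p'<n q'<n (pq⊑ , pq≢)
    with orbit (meet (var (fromℕ< p<n)) (var (fromℕ< q<n))) (meet (var (fromℕ< p'<n)) (var (fromℕ< q'<n)))
  ... | ≡⇔ , ⊑⇔ rewrite toℕ-fromℕ< p<n | toℕ-fromℕ< q<n | toℕ-fromℕ< p'<n | toℕ-fromℕ< q'<n =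
    Equivalence.to ⊑⇔ pq⊑ , pq≢ ∘ Equivalence.from ≡⇔

  +-preserves-⊏ : ∀ d {p q p' q'} → d + p ≤ n → d + q ≤ n → d + p' ≤ n → d + q' ≤ n →
                  p ⋏ q ⊏ p' ⋏ q' → d + p ⋏ d + q ⊏ d + p' ⋏ d + q'
  +-preserves-⊏ zero    _   _   _    _    lt = lt
  +-preserves-⊏ (suc d) p<n q<n p'<n q'<n lt = suc-preserves-⊏ p<n q<n p'<n q'<n
    (+-preserves-⊏ d (<⇒≤ p<n) (<⇒≤ q<n) (<⇒≤ p'<n) (<⇒≤ q'<n) lt)

  module Stride (k : ℕ) where
    AscendingCase DescendingCase : ℕ → ℕ → ℕ → ℕ → Set (a ⊔ ℓ)
    AscendingCase i₁ i₂ j₁ j₂ = 0 ⋏ k ⊏ k ⋏ 2 * k →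
      (i₁ ⋏ i₂ ≡ i₁ ⋏ i₁ + k) ×
      ((i₁ < j₁ → i₁ ⋏ i₂ ⊏ j₁ ⋏ j₂) × (i₁ ≡ j₁ → i₁ ⋏ i₂ ≡ j₁ ⋏ j₂) × (j₁ < i₁ → j₁ ⋏ j₂ ⊏ i₁ ⋏ i₂))
    DescendingCase i₁ i₂ j₁ j₂ = k ⋏ 2 * k ⊏ 0 ⋏ k →
      (i₁ ⋏ i₂ ≡ i₂ ∸ k ⋏ i₂) ×
      ((j₂ < i₂ → i₁ ⋏ i₂ ⊏ j₁ ⋏ j₂) × (j₂ ≡ i₂ → i₁ ⋏ i₂ ≡ j₁ ⋏ j₂) × (i₂ < j₂ → j₁ ⋏ j₂ ⊏ i₁ ⋏ i₂))

    module Progression (r : ℕ) where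
      -- recursive rather than r + t * k, so that index (suc t) is index t + k by definition
      index : ℕ → ℕ
      index zero    = r
      index (suc t) = index t + k

      index≡r+t*k : ∀ t → index t ≡ r + t * k
      index≡r+t*k zero    = sym (+-identityʳ r)
      index≡r+t*k (suc t) = begin
        index t + k      ≡⟨ cong (_+ k) (index≡r+t*k t) ⟩
        r + t * k + k    ≡⟨ +-assoc r (t * k) k ⟩
        r + (t * k + k)  ≡⟨ cong (r +_) (+-comm (t * k) k) ⟩
        r + suc t * k    ∎
        where open ≡-Reasoning

      index-+2k : ∀ t → index t + 2 * k ≡ index (2 + t)
      index-+2k t = trans (cong (λ j → index t + (k + j)) (+-identityʳ k)) (sym (+-assoc (index t) k k))

      index-mono : ∀ {s t} → s ≤ t → index s ≤ index t
      index-mono = go ∘ ≤⇒≤′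
        where
        go : ∀ {s t} → s ≤′ t → index s ≤ index t
        go ≤′-refl        = ≤-refl
        go (≤′-step s≤t) = ≤-trans (go s≤t) (m≤m+n _ k)

      index-cancel-< : ∀ {s t} → index s < index t → s < t
      index-cancel-< lt = ≰⇒> (<⇒≱ lt ∘ index-mono)

      open Path (η ∘ index)

      shift-into-progression : ∀ t → index (2 + t) ≤ n → ∀ {p q p' q'} →
        p ≤ 2 * k → q ≤ 2 * k → p' ≤ 2 * k → q' ≤ 2 * k →
        p ⋏ q ⊏ p' ⋏ q' → index t + p ⋏ index t + q ⊏ index t + p' ⋏ index t + q'
      shift-into-progression t h p≤ q≤ p'≤ q'≤ =
        +-preserves-⊏ (index t) (bound p≤) (bound q≤) (bound p'≤) (bound q'≤)
        where
        bound : ∀ {p} → p ≤ 2 * k → index t + p ≤ n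
        bound p≤ = ≤-trans (+-monoʳ-≤ (index t) p≤) (subst (_≤ n) (sym (index-+2k t)) h)

      shifted-δ : ∀ t → index t + 0 ⋏ index t + k ≡ δ t
      shifted-δ t = cong (_⋏ index (suc t)) (+-identityʳ (index t))

      shifted-δ-suc : ∀ t → index t + k ⋏ index t + 2 * k ≡ δ (suc t)
      shifted-δ-suc t = cong (index (suc t) ⋏_) (index-+2k t)

      k≤2k : k ≤ 2 * k
      k≤2k = m≤m+n k (k + 0)

      ascending : 0 ⋏ k ⊏ k ⋏ 2 * k → ∀ {m} → index m ≤ n → Ascending m
      ascending base h {t} t+1<m = subst₂ _⊏_ (shifted-δ t) (shifted-δ-suc t)
        (shift-into-progression t (≤-trans (index-mono t+1<m) h) z≤n k≤2k k≤2k ≤-refl base)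

      descending : k ⋏ 2 * k ⊏ 0 ⋏ k → ∀ {m} → index m ≤ n → Descending m
      descending base h {t} t+1<m = subst₂ _⊏_ (shifted-δ-suc t) (shifted-δ t)
        (shift-into-progression t (≤-trans (index-mono t+1<m) h) k≤2k ≤-refl z≤n k≤2k base)

      ascending-case : ∀ {s₁ s₂ s'₁ s'₂} → s₁ < s₂ → s'₁ < s'₂ → index s₂ ≤ n → index s'₂ ≤ n →
        AscendingCase (index s₁) (index s₂) (index s'₁) (index s'₂)
      ascending-case {s₁} {_} {s'₁} s₁<s₂ s'₁<s'₂ h h' base = collapse , ordered , equal , reversed
        where
        asc  = ascending base h
        asc' = ascending base h'
        collapse  = ascending⇒∧≡δ asc  s₁<s₂   ≤-refl
        collapse' = ascending⇒∧≡δ asc' s'₁<s'₂ ≤-refl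
        ordered = λ lt → subst₂ _⊏_ (sym collapse) (sym collapse')
          (consecutive⇒ordered {R = _⊏_} ⊏-trans δ asc' (index-cancel-< {s₁} {s'₁} lt) s'₁<s'₂)
        reversed = λ lt → subst₂ _⊏_ (sym collapse') (sym collapse)
          (consecutive⇒ordered {R = _⊏_} ⊏-trans δ asc (index-cancel-< {s'₁} {s₁} lt) s₁<s₂)
        equal = λ e → trans collapse (trans (cong (λ i → i ⋏ i + k) e) (sym collapse'))

      descending-case : ∀ {s₁ t₂ s'₁ t'₂} → s₁ ≤ t₂ → s'₁ ≤ t'₂ → index (suc t₂) ≤ n → index (suc t'₂) ≤ n →
        DescendingCase (index s₁) (index (suc t₂)) (index s'₁) (index (suc t'₂))
      descending-case {t₂ = t₂} {t'₂ = t'₂} s₁≤t₂ s'₁≤t'₂ h h' base = collapse , ordered , equal , reversed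
        where
        desc  = descending base h
        desc' = descending base h'
        meet≡δ  = descending⇒∧≡δ desc  s₁≤t₂   ≤-refl
        meet≡δ' = descending⇒∧≡δ desc' s'₁≤t'₂ ≤-refl
        collapse  = trans meet≡δ  (cong (_⋏ index (suc t₂))  (sym (m+n∸n≡m (index t₂) k)))
        collapse' = trans meet≡δ' (cong (_⋏ index (suc t'₂)) (sym (m+n∸n≡m (index t'₂) k)))
        ordered = λ lt → subst₂ _⊏_ (sym meet≡δ) (sym meet≡δ')
          (consecutive⇒ordered {R = flip _⊏_} ⊐-trans δ desc
            (≤-pred (index-cancel-< {suc t'₂} {suc t₂} lt)) (n<1+n t₂))
        reversed = λ lt → subst₂ _⊏_ (sym meet≡δ') (sym meet≡δ)
          (consecutive⇒ordered {R = flip _⊏_} ⊐-trans δ desc'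
            (≤-pred (index-cancel-< {suc t₂} {suc t'₂} lt)) (n<1+n t'₂))
        equal = λ e → trans collapse (trans (cong (λ i → i ∸ k ⋏ i) (sym e)) (sym collapse'))

      both-cases : ∀ {s₁ s₂ s'₁ s'₂} → s₁ < s₂ → s'₁ < s'₂ → index s₂ ≤ n → index s'₂ ≤ n →
        AscendingCase (index s₁) (index s₂) (index s'₁) (index s'₂) ×
        DescendingCase (index s₁) (index s₂) (index s'₁) (index s'₂)
      both-cases s₁<s₂@(s≤s s₁≤t₂) s'₁<s'₂@(s≤s s'₁≤t'₂) h h' =
        ascending-case s₁<s₂ s'₁<s'₂ h h' , descending-case s₁≤t₂ s'₁≤t'₂ h h'

    module _ .{{_ : NonZero k}} where
      residue-class : ∀ {r} i → i % k ≡ r → ∃[ s ] i ≡ Progression.index r s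
      residue-class i refl = i / k , trans (m≡m%n+[m/n]*n i k) (sym (index≡r+t*k (i / k)))
        where open Progression (i % k)

      both-cases-on-residue-class : ∀ {r i₁ i₂ j₁ j₂} → i₁ % k ≡ r → i₂ % k ≡ r → j₁ % k ≡ r → j₂ % k ≡ r →
        i₂ ≤ n → j₂ ≤ n → i₁ < i₂ → j₁ < j₂ →
        AscendingCase i₁ i₂ j₁ j₂ × DescendingCase i₁ i₂ j₁ j₂
      both-cases-on-residue-class {r} {i₁} {i₂} {j₁} {j₂} p₁ p₂ p₃ p₄ h h' lt lt'
        with residue-class i₁ p₁ | residue-class i₂ p₂ | residue-class j₁ p₃ | residue-class j₂ p₄
      ... | s₁ , refl | s₂ , refl | s'₁ , refl | s'₂ , refl =
        both-cases (index-cancel-< {s₁} {s₂} lt) (index-cancel-< {s'₁} {s'₂} lt') h h'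
        where open Progression r

proposition5p8 : ∀ {a ℓ : Level} (T : MeetTree a ℓ) (n : ℕ) (η : ℕ → MeetTree.Carrier T) →
  PartialOrbit T n η →
  (k : ℕ) → .{{_ : NonZero k}} → 2 * k ≤ n →
  (i₁ i₂ j₁ j₂ : ℕ) → i₁ ≤ n → i₂ ≤ n → j₁ ≤ n → j₂ ≤ n →
  i₁ % k ≡ i₂ % k → i₂ % k ≡ j₁ % k → j₁ % k ≡ j₂ % k →
  i₁ < i₂ → j₁ < j₂ →
  (ltᵀ T (meetᵀ T (η 0) (η k)) (meetᵀ T (η k) (η (2 * k))) →
    (meetᵀ T (η i₁) (η i₂) ≡ meetᵀ T (η i₁) (η (i₁ + k))) ×
    ((i₁ < j₁ → ltᵀ T (meetᵀ T (η i₁) (η i₂)) (meetᵀ T (η j₁) (η j₂))) ×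
     (i₁ ≡ j₁ → meetᵀ T (η i₁) (η i₂) ≡ meetᵀ T (η j₁) (η j₂)) ×
     (j₁ < i₁ → ltᵀ T (meetᵀ T (η j₁) (η j₂)) (meetᵀ T (η i₁) (η i₂))))) ×
  (ltᵀ T (meetᵀ T (η k) (η (2 * k))) (meetᵀ T (η 0) (η k)) →
    (meetᵀ T (η i₁) (η i₂) ≡ meetᵀ T (η (i₂ ∸ k)) (η i₂)) ×
    ((j₂ < i₂ → ltᵀ T (meetᵀ T (η i₁) (η i₂)) (meetᵀ T (η j₁) (η j₂))) ×
     (j₂ ≡ i₂ → meetᵀ T (η i₁) (η i₂) ≡ meetᵀ T (η j₁) (η j₂)) ×
     (i₂ < j₂ → ltᵀ T (meetᵀ T (η j₁) (η j₂)) (meetᵀ T (η i₁) (η i₂)))))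
proposition5p8 T n η orbit k _ i₁ i₂ j₁ j₂ _ i₂≤n _ j₂≤n i₁~i₂ i₂~j₁ j₁~j₂ =
  both-cases-on-residue-class refl (sym i₁~i₂) (sym (trans i₁~i₂ i₂~j₁))
    (sym (trans i₁~i₂ (trans i₂~j₁ j₁~j₂))) i₂≤n j₂≤n
  where
  open OrbitProperties T n η orbit
  open Stride k
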